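{- Let $Ag$ be a finite set of agents, $V$ a set of propositional variables, and let $(\Gamma,\Delta)$ be an inseparable pair of subsets of $\mathcal{L}^{Ag}_V$ such that both $|\Gamma|$ and $|\Delta|$ are at most countable. Then: 1. There exist $\Gamma'$ and $\Delta'$ such that $\Gamma \subseteq \Gamma' \subseteq \mathcal{L}^{Ag(\Gamma)}_{|\Gamma|}$, $\Delta \subseteq \Delta' \subseteq \mathcal{L}^{Ag(\Delta)}_{|\Delta|}$, $(\Gamma',\Delta')$ is inseparable, $\Gamma'$ is $(Ag(\Gamma),|\Gamma|)$-maxiconsistent, and $\Delta'$ is $(Ag(\Delta),|\Delta|)$-maxiconsistent. 2. If $\Gamma' \subseteq \Gamma$ and $\Delta' \subseteq \Delta$, then $(\Gamma',\Delta')$ is inseparable.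
   Context: $\mathcal{L}^{Ag}_V$ is the set of stit formulas given by $A ::= p \mid A \to A \mid \bot \mid \Box A \mid [j]A$ with $p \in V$, $j \in Ag$ (other Boolean connectives defined as usual; $\Diamond A := \neg\Box\neg A$). $\vdash A$ means derivability in the axiom system $\mathbb{S}$ with axioms: all classical propositional tautologies; S5 axioms for $\Box$ and each $[j]$; $\Box A \to [j]A$; and $(\Diamond[j_1]A_1 \wedge\dots\wedge \Diamond[j_k]A_k) \to \Diamond([j_1]A_1\wedge\dots\wedge[j_k]A_k)$ for pairwise distinct $j_1,\dots,j_k$; rules: modus ponens and necessitation for $\Box$. For a set $\Gamma$ of formulas, $\Gamma\vdash A$ means $\vdash (A_1\wedge\dots\wedge A_r)\to A$ for some $A_1,\dots,A_r\in\Gamma$; $\Gamma$ is consistent iff not $\Gamma\vdash\bot$; $\Gamma$ is $(Ag',V')$-maxiconsistent iff $\Gamma\subseteq \mathcal{L}^{Ag'}_{V'}$ is consistent and no consistent subset of $\mathcal{L}^{Ag'}_{V'}$ properly extends it. $|\Gamma|$ is the set of propositional variables occurring in $\Gamma$, $Ag(\Gamma)$ the set of agent indices occurring in $\Gamma$. A pair $(\Gamma,\Delta)$ is inseparable iff $Ag(\Gamma)\cap Ag(\Delta)=\emptyset$ and there is no $C\in\mathcal{L}^{Ag(\Gamma)\cup Ag(\Delta)}_{|\Gamma|\cap|\Delta|}$ with $\Gamma\vdash C$ and $\Delta\vdash\neg C$. -}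

module Defs where

open import Level using (0ℓ) public
open import Data.Nat using (ℕ) public
open import Data.Fin using (Fin) public
open import Data.Bool using (Bool; true; false; not; _∨_)
open import Data.List using (List; []; _∷_; map)
open import Data.List.Relation.Unary.All using (All)
open import Data.List.Relation.Unary.Unique.Propositional using (Unique)
open import Data.Product using (Σ; ∃; _×_; _,_; proj₁; proj₂) public
open import Relation.Binary.PropositionalEquality using (_≡_) public
open import Relation.Nullary using (¬_) public
open import Relation.Unary using (Pred; _⊆_; _∈_; _∉_; _∪_; _∩_) public
open import Axiom.ExcludedMiddle using (ExcludedMiddle) public

-- Stit formulas L^{Ag}_V with Ag = Fin n (a finite set of agents) and
-- V an arbitrary type of propositional variables.
data Fm (V : Set) (n : ℕ) : Set where
  var  : V → Fm V n
  _⇒_  : Fm V n → Fm V n → Fm V n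
  ⊥'   : Fm V n
  □    : Fm V n → Fm V n
  [_]_ : Fin n → Fm V n → Fm V n

infixr 5 _⇒_

module _ {V : Set} {n : ℕ} where

  ~_ : Fm V n → Fm V n
  ~ A = A ⇒ ⊥'

  ⊤' : Fm V n
  ⊤' = ~ ⊥'

  _∧'_ : Fm V n → Fm V n → Fm V n
  A ∧' B = ~ (A ⇒ ~ B)

  ◇ : Fm V n → Fm V n
  ◇ A = ~ □ (~ A)

  conj : List (Fm V n) → Fm V n
  conj []       = ⊤'
  conj (A ∷ As) = A ∧' conj As

  eval : (Fm V n → Bool) → Fm V n → Bool
  eval v (var p)   = v (var p)
  eval v (A ⇒ B)   = not (eval v A) ∨ eval v B
  eval v ⊥'        = false
  eval v (□ A)     = v (□ A)
  eval v ([ j ] A) = v ([ j ] A)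

  -- (instances of) classical propositional tautologies
  Tautology : Fm V n → Set
  Tautology A = ∀ (v : Fm V n → Bool) → eval v A ≡ true

  boxes : List (Fin n × Fm V n) → List (Fm V n)
  boxes []             = []
  boxes ((j , A) ∷ js) = ([ j ] A) ∷ boxes js

  diaBoxes : List (Fin n × Fm V n) → List (Fm V n)
  diaBoxes []             = []
  diaBoxes ((j , A) ∷ js) = ◇ ([ j ] A) ∷ diaBoxes js

  data ⊢_ : Fm V n → Set where
    taut  : ∀ {A} → Tautology A → ⊢ A
    □K    : ∀ {A B} → ⊢ (□ (A ⇒ B) ⇒ □ A ⇒ □ B)
    □T    : ∀ {A} → ⊢ (□ A ⇒ A)
    □5    : ∀ {A} → ⊢ (◇ A ⇒ □ (◇ A))
    agK   : ∀ {j A B} → ⊢ ([ j ] (A ⇒ B) ⇒ [ j ] A ⇒ [ j ] B)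
    agT   : ∀ {j A} → ⊢ ([ j ] A ⇒ A)
    ag5   : ∀ {j A} → ⊢ (~ [ j ] (~ A) ⇒ [ j ] (~ [ j ] (~ A)))
    □ag   : ∀ {j A} → ⊢ (□ A ⇒ [ j ] A)
    indep : ∀ (js : List (Fin n × Fm V n)) → Unique (map proj₁ js) →
            ⊢ (conj (diaBoxes js) ⇒ ◇ (conj (boxes js)))
    mp    : ∀ {A B} → ⊢ (A ⇒ B) → ⊢ A → ⊢ B
    nec   : ∀ {A} → ⊢ A → ⊢ □ A

  FmSet : Set₁
  FmSet = Pred (Fm V n) 0ℓ

  _⊢'_ : FmSet → Fm V n → Set
  Γ ⊢' A = Σ (List (Fm V n)) λ As → All (_∈ Γ) As × (⊢ (conj As ⇒ A))

  Consistent : FmSet → Set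
  Consistent Γ = ¬ (Γ ⊢' ⊥')

  data OccV (p : V) : Fm V n → Set where
    here : OccV p (var p)
    ⇒ˡ   : ∀ {A B} → OccV p A → OccV p (A ⇒ B)
    ⇒ʳ   : ∀ {A B} → OccV p B → OccV p (A ⇒ B)
    □o   : ∀ {A} → OccV p A → OccV p (□ A)
    ago  : ∀ {j A} → OccV p A → OccV p ([ j ] A)

  data OccA (i : Fin n) : Fm V n → Set where
    here : ∀ {A} → OccA i ([ i ] A)
    ⇒ˡ   : ∀ {A B} → OccA i A → OccA i (A ⇒ B)
    ⇒ʳ   : ∀ {A B} → OccA i B → OccA i (A ⇒ B)
    □o   : ∀ {A} → OccA i A → OccA i (□ A)
    ago  : ∀ {j A} → OccA i A → OccA i ([ j ] A)

  Lang : Pred (Fin n) 0ℓ → Pred V 0ℓ → FmSet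
  Lang Ag' V' A = (∀ p → OccV p A → p ∈ V') × (∀ j → OccA j A → j ∈ Ag')

  -- |Γ| and Ag(Γ)
  vars : FmSet → Pred V 0ℓ
  vars Γ p = Σ (Fm V n) λ A → A ∈ Γ × OccV p A

  agents : FmSet → Pred (Fin n) 0ℓ
  agents Γ j = Σ (Fm V n) λ A → A ∈ Γ × OccA j A

  MaxiConsistent : Pred (Fin n) 0ℓ → Pred V 0ℓ → FmSet → Set₁
  MaxiConsistent Ag' V' Γ =
    Γ ⊆ Lang Ag' V' × Consistent Γ ×
    ¬ (Σ FmSet λ Δ → Δ ⊆ Lang Ag' V' × Consistent Δ × Γ ⊆ Δ ×
         Σ (Fm V n) λ A → A ∈ Δ × A ∉ Γ)

  Inseparable : FmSet → FmSet → Set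
  Inseparable Γ Δ =
    (∀ j → j ∈ agents Γ → j ∈ agents Δ → Data.Empty.⊥) ×
    ¬ (Σ (Fm V n) λ C → C ∈ Lang (agents Γ ∪ agents Δ) (vars Γ ∩ vars Δ) ×
         Γ ⊢' C × Δ ⊢' (~ C))
    where import Data.Empty

AtMostCountable : {V : Set} → Pred V 0ℓ → Set
AtMostCountable {V} P =
  Σ (V → ℕ) λ f → ∀ {p q} → p ∈ P → q ∈ P → f p ≡ f q → p ≡ q

{-# OPTIONS --safe #-}
-- Fix the shared language L of Γ and Δ.
-- If C₁ separates (Γ ∪ {A}, Δ) and C₂ separates (Γ ∪ {¬A}, Δ) within L, then ¬C₁ → C₂ separates
-- (Γ, Δ); so, running through an enumeration of the (countable) language of Γ and adding each
-- formula or its negation, Γ grows to a complete set Γ⁺ still inseparable from Δ.  Doing the same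
-- for Δ against Γ⁺ gives Δ⁺.  Inseparability makes both sets consistent, so completeness makes them
-- maxiconsistent, and inseparability within L survives shrinking the vocabulary, which also gives
-- the second part.
module Submission where

open import Defs
open import Data.Bool using (Bool; true; false; not; _∨_; _∧_; T)
open import Data.Bool.Properties using (T-≡; T-∧)
open import Data.Empty using (⊥-elim)
open import Data.Fin using (zero; suc)
import Data.Fin as Fin
import Data.Fin.Properties as Fin
open import Data.List using (List; []; _∷_; _++_)
open import Data.List.Relation.Unary.All as All using (All; []; _∷_)
open import Data.List.Relation.Unary.All.Properties using (++⁺)
open import Data.Nat using (zero; suc; _⊔_; _≤′_; ≤′-refl; ≤′-step)
open import Data.Nat.Properties using (m≤m⊔n; m≤n⊔m; ≤⇒≤′)
open import Data.Nat.Binary using (ℕᵇ; 2[1+_]; 1+[2_])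
import Data.Nat.Binary as Bin
import Data.Nat.Binary.Properties as Bin
open import Data.Sum as Sum using (_⊎_; inj₁; inj₂)
open import Data.Vec using (Vec; []; _∷_; lookup; map)
open import Data.Vec.Properties using (lookup-map)
open import Function using (_∘_)
open import Function.Bundles using (Equivalence)
open import Relation.Binary.PropositionalEquality using (refl; sym; cong₂; trans)
open import Relation.Nullary using (Dec; yes; no)
open import Relation.Unary using (｛_｝)

Enumeration : {A : Set} → Pred A 0ℓ → Set
Enumeration {A} P = Σ (ℕ → A) λ e → (∀ k → e k ∈ P) × (∀ {x} → x ∈ P → ∃ λ k → e k ≡ x)

enumerate : ExcludedMiddle 0ℓ → {A : Set} {P : Pred A 0ℓ} {x₀ : A} →
            x₀ ∈ P → AtMostCountable P → Enumeration P
enumerate em {A} {P} {x₀} x₀∈P (c , c-injective) = e , e∈P , e-onto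
  where
  HasCode : ℕ → Set
  HasCode k = ∃ λ x → x ∈ P × c x ≡ k

  decode : ∀ {k} → Dec (HasCode k) → A
  decode (yes (x , _)) = x
  decode (no _)        = x₀

  e : ℕ → A
  e k = decode (em {HasCode k})

  decode∈P : ∀ {k} (d : Dec (HasCode k)) → decode d ∈ P
  decode∈P (yes (_ , x∈P , _)) = x∈P
  decode∈P (no _)              = x₀∈P

  e∈P : ∀ k → e k ∈ P
  e∈P k = decode∈P em

  decode-code : ∀ {x} → x ∈ P → (d : Dec (HasCode (c x))) → decode d ≡ x
  decode-code x∈P (yes (y , y∈P , cy≡cx)) = c-injective y∈P x∈P cy≡cx
  decode-code x∈P (no ¬code)              = ⊥-elim (¬code (_ , x∈P , refl))

  e-onto : ∀ {x} → x ∈ P → ∃ λ k → e k ≡ x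
  e-onto {x} x∈P = c x , decode-code x∈P em

-- tag m b prefixes b with the self-delimiting code of m, which makes code uniquely decodable.
tag : ℕ → ℕᵇ → ℕᵇ
tag zero    b = 1+[2 b ]
tag (suc m) b = 2[1+ tag m b ]

tag-injective : ∀ m m' {b b'} → tag m b ≡ tag m' b' → m ≡ m' × b ≡ b'
tag-injective zero    zero     refl = refl , refl
tag-injective (suc m) (suc m') eq with refl , refl ← tag-injective m m' (Bin.2[1+_]-injective eq) = refl , refl
tag-injective zero    (suc _)  ()
tag-injective (suc _) zero     ()

module _ {V : Set} {n : ℕ} where

  code : (V → ℕ) → Fm V n → ℕᵇ → ℕᵇ
  code f (var p)   b = tag 0 (tag (f p) b)
  code f (A ⇒ B)   b = tag 1 (code f A (code f B b))
  code f ⊥'        b = tag 2 b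
  code f (□ A)     b = tag 3 (code f A b)
  code f ([ j ] A) b = tag 4 (tag (Fin.toℕ j) (code f A b))

  module _ {S : Pred V 0ℓ} {f : V → ℕ} (f-injective : ∀ {p q} → p ∈ S → q ∈ S → f p ≡ f q → p ≡ q) where

    VarsIn : Fm V n → Set
    VarsIn A = ∀ p → OccV p A → p ∈ S

    code-injective : ∀ {A B b c} → VarsIn A → VarsIn B → code f A b ≡ code f B c → A ≡ B × b ≡ c
    code-injective {var p} {var q} A-vars B-vars eq
      with refl , eq₁ ← tag-injective 0 0 eq
      with f-p≡f-q , eq₂ ← tag-injective (f p) (f q) eq₁
      with refl ← f-injective (A-vars p here) (B-vars q here) f-p≡f-q = refl , eq₂
    code-injective {A ⇒ B} {A' ⇒ B'} A-vars B-vars eq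
      with refl , eq₁ ← tag-injective 1 1 eq
      with refl , eq₂ ← code-injective (λ p → A-vars p ∘ ⇒ˡ) (λ p → B-vars p ∘ ⇒ˡ) eq₁
      with refl , eq₃ ← code-injective (λ p → A-vars p ∘ ⇒ʳ) (λ p → B-vars p ∘ ⇒ʳ) eq₂ = refl , eq₃
    code-injective {⊥'} {⊥'} _ _ eq = refl , proj₂ (tag-injective 2 2 eq)
    code-injective {□ A} {□ A'} A-vars B-vars eq
      with refl , eq₁ ← tag-injective 3 3 eq
      with refl , eq₂ ← code-injective (λ p → A-vars p ∘ □o) (λ p → B-vars p ∘ □o) eq₁ = refl , eq₂
    code-injective {[ j ] A} {[ j' ] A'} A-vars B-vars eq
      with refl , eq₁ ← tag-injective 4 4 eq
      with j≡j' , eq₂ ← tag-injective (Fin.toℕ j) (Fin.toℕ j') eq₁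
      with refl ← Fin.toℕ-injective j≡j'
      with refl , eq₃ ← code-injective (λ p → A-vars p ∘ ago) (λ p → B-vars p ∘ ago) eq₂ = refl , eq₃
    code-injective {var _}   {_ ⇒ _}   _ _ ()
    code-injective {var _}   {⊥'}      _ _ ()
    code-injective {var _}   {□ _}     _ _ ()
    code-injective {var _}   {[ _ ] _} _ _ ()
    code-injective {_ ⇒ _}   {var _}   _ _ ()
    code-injective {_ ⇒ _}   {⊥'}      _ _ ()
    code-injective {_ ⇒ _}   {□ _}     _ _ ()
    code-injective {_ ⇒ _}   {[ _ ] _} _ _ ()
    code-injective {⊥'}      {var _}   _ _ ()
    code-injective {⊥'}      {_ ⇒ _}   _ _ ()
    code-injective {⊥'}      {□ _}     _ _ ()
    code-injective {⊥'}      {[ _ ] _} _ _ ()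
    code-injective {□ _}     {var _}   _ _ ()
    code-injective {□ _}     {_ ⇒ _}   _ _ ()
    code-injective {□ _}     {⊥'}      _ _ ()
    code-injective {□ _}     {[ _ ] _} _ _ ()
    code-injective {[ _ ] _} {var _}   _ _ ()
    code-injective {[ _ ] _} {_ ⇒ _}   _ _ ()
    code-injective {[ _ ] _} {⊥'}      _ _ ()
    code-injective {[ _ ] _} {□ _}     _ _ ()

  Lang-countable : ∀ {Ag' : Pred (Fin n) 0ℓ} {S : Pred V 0ℓ} → AtMostCountable S → AtMostCountable (Lang Ag' S)
  Lang-countable (f , f-injective) =
    (λ A → Bin.toℕ (code f A Bin.zero)) ,
    λ (A-vars , _) (B-vars , _) → proj₁ ∘ code-injective f-injective A-vars B-vars ∘ Bin.toℕ-injective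

-- Classical tautologies are derived as instances of schemata whose validity is decided by truth tables.
data Schema (k : ℕ) : Set where
  atom : Fin k → Schema k
  _⇛_  : Schema k → Schema k → Schema k
  ⊥ˢ   : Schema k

infixr 5 _⇛_
infixr 6 _∧ˢ_

¬ˢ_ : ∀ {k} → Schema k → Schema k
¬ˢ s = s ⇛ ⊥ˢ

⊤ˢ : ∀ {k} → Schema k
⊤ˢ = ¬ˢ ⊥ˢ

_∧ˢ_ : ∀ {k} → Schema k → Schema k → Schema k
s ∧ˢ t = ¬ˢ (s ⇛ ¬ˢ t)

x₀ : ∀ {k} → Schema (suc k)
x₀ = atom zero

x₁ : ∀ {k} → Schema (suc (suc k))
x₁ = atom (suc zero)

x₂ : ∀ {k} → Schema (suc (suc (suc k)))
x₂ = atom (suc (suc zero))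

x₃ : ∀ {k} → Schema (suc (suc (suc (suc k))))
x₃ = atom (suc (suc (suc zero)))

x₄ : ∀ {k} → Schema (suc (suc (suc (suc (suc k)))))
x₄ = atom (suc (suc (suc (suc zero))))

x₅ : ∀ {k} → Schema (suc (suc (suc (suc (suc (suc k))))))
x₅ = atom (suc (suc (suc (suc (suc zero)))))

⟦_⟧ : ∀ {k} → Schema k → Vec Bool k → Bool
⟦ atom i ⟧ ρ = lookup ρ i
⟦ s ⇛ t ⟧  ρ = not (⟦ s ⟧ ρ) ∨ ⟦ t ⟧ ρ
⟦ ⊥ˢ ⟧     ρ = false

allAssignments : ∀ k → (Vec Bool k → Bool) → Bool
allAssignments zero    F = F []
allAssignments (suc k) F = allAssignments k (F ∘ (true ∷_)) ∧ allAssignments k (F ∘ (false ∷_))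

allAssignments-sound : ∀ k F → T (allAssignments k F) → ∀ ρ → T (F ρ)
allAssignments-sound zero    F ok [] = ok
allAssignments-sound (suc k) F ok (true ∷ ρ) =
  allAssignments-sound k (F ∘ (true ∷_)) (proj₁ (Equivalence.to T-∧ ok)) ρ
allAssignments-sound (suc k) F ok (false ∷ ρ) =
  allAssignments-sound k (F ∘ (false ∷_)) (proj₂ (Equivalence.to T-∧ ok)) ρ

Valid : ∀ {k} → Schema k → Set
Valid {k} s = T (allAssignments k ⟦ s ⟧)

module _ {V : Set} {n : ℕ} where

  _[_] : ∀ {k} → Schema k → Vec (Fm V n) k → Fm V n
  atom i  [ σ ] = lookup σ i
  (s ⇛ t) [ σ ] = s [ σ ] ⇒ t [ σ ]
  ⊥ˢ      [ σ ] = ⊥'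

  eval-[] : ∀ {k} v (s : Schema k) (σ : Vec (Fm V n) k) → eval v (s [ σ ]) ≡ ⟦ s ⟧ (map (eval v) σ)
  eval-[] v (atom i) σ = sym (lookup-map i (eval v) σ)
  eval-[] v (s ⇛ t) σ = cong₂ (λ a b → not a ∨ b) (eval-[] v s σ) (eval-[] v t σ)
  eval-[] v ⊥ˢ      σ = refl

  tautology : ∀ {k} (s : Schema k) {_ : Valid s} (σ : Vec (Fm V n) k) → ⊢ (s [ σ ])
  tautology s {valid} σ = taut λ v →
    trans (eval-[] v s σ) (Equivalence.to T-≡ (allAssignments-sound _ ⟦ s ⟧ valid (map (eval v) σ)))

  infixl 5 _·_

  _·_ : ∀ {A B : Fm V n} → ⊢ (A ⇒ B) → ⊢ A → ⊢ B
  _·_ = mp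

  conj-++ : ∀ (As Bs : List (Fm V n)) → ⊢ (conj (As ++ Bs) ⇒ conj As ∧' conj Bs)
  conj-++ []       Bs = tautology (x₀ ⇛ ⊤ˢ ∧ˢ x₀) (conj Bs ∷ [])
  conj-++ (A ∷ As) Bs =
    tautology ((x₀ ⇛ x₁ ∧ˢ x₂) ⇛ x₃ ∧ˢ x₀ ⇛ (x₃ ∧ˢ x₁) ∧ˢ x₂)
              (conj (As ++ Bs) ∷ conj As ∷ conj Bs ∷ A ∷ [])
    · conj-++ As Bs

  module _ {Γ : FmSet {V} {n}} where

    ⊢'-theorem : ∀ {A} → ⊢ A → Γ ⊢' A
    ⊢'-theorem {A} ⊢A = [] , [] , tautology (x₀ ⇛ ⊤ˢ ⇛ x₀) (A ∷ []) · ⊢A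

    ⊢'-assumption : ∀ {A} → A ∈ Γ → Γ ⊢' A
    ⊢'-assumption {A} A∈Γ = A ∷ [] , A∈Γ ∷ [] , tautology (x₀ ∧ˢ ⊤ˢ ⇛ x₀) (A ∷ [])

    ⊢'-mp : ∀ {A B} → Γ ⊢' A → ⊢ (A ⇒ B) → Γ ⊢' B
    ⊢'-mp {A} {B} (As , As⊆Γ , ⊢A) ⊢A⇒B =
      As , As⊆Γ , tautology ((x₀ ⇛ x₁) ⇛ (x₁ ⇛ x₂) ⇛ x₀ ⇛ x₂) (conj As ∷ A ∷ B ∷ []) · ⊢A · ⊢A⇒B

    ⊢'-mp₂ : ∀ {A B C} → Γ ⊢' A → Γ ⊢' B → ⊢ (A ⇒ B ⇒ C) → Γ ⊢' C
    ⊢'-mp₂ {A} {B} {C} (As , As⊆Γ , ⊢A) (Bs , Bs⊆Γ , ⊢B) ⊢A⇒B⇒C =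
      As ++ Bs , ++⁺ As⊆Γ Bs⊆Γ ,
      tautology ((x₀ ⇛ x₁ ∧ˢ x₂) ⇛ (x₁ ⇛ x₃) ⇛ (x₂ ⇛ x₄) ⇛ (x₃ ⇛ x₄ ⇛ x₅) ⇛ x₀ ⇛ x₅)
                (conj (As ++ Bs) ∷ conj As ∷ conj Bs ∷ A ∷ B ∷ C ∷ [])
      · conj-++ As Bs · ⊢A · ⊢B · ⊢A⇒B⇒C

    ⊢'-deduction : ∀ {B C} → (Γ ∪ ｛ B ｝) ⊢' C → Γ ⊢' (B ⇒ C)
    ⊢'-deduction {B} {C} (As , As⊆Γ∪B , ⊢C) with discharge As As⊆Γ∪B
      where
      discharge : ∀ As → All (Γ ∪ ｛ B ｝) As →
                  Σ (List (Fm V n)) λ Bs → All Γ Bs × ⊢ (conj Bs ⇒ B ⇒ conj As)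
      discharge [] [] = [] , [] , tautology (⊤ˢ ⇛ x₀ ⇛ ⊤ˢ) (B ∷ [])
      discharge (A ∷ As) (inj₁ A∈Γ ∷ As⊆Γ∪B) with discharge As As⊆Γ∪B
      ... | Bs , Bs⊆Γ , ⊢Bs = A ∷ Bs , A∈Γ ∷ Bs⊆Γ ,
        tautology ((x₀ ⇛ x₁ ⇛ x₂) ⇛ x₃ ∧ˢ x₀ ⇛ x₁ ⇛ x₃ ∧ˢ x₂) (conj Bs ∷ B ∷ conj As ∷ A ∷ []) · ⊢Bs
      discharge (A ∷ As) (inj₂ refl ∷ As⊆Γ∪B) with discharge As As⊆Γ∪B
      ... | Bs , Bs⊆Γ , ⊢Bs = Bs , Bs⊆Γ ,
        tautology ((x₀ ⇛ x₁ ⇛ x₂) ⇛ x₀ ⇛ x₁ ⇛ x₁ ∧ˢ x₂) (conj Bs ∷ B ∷ conj As ∷ []) · ⊢Bs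
    ... | Bs , Bs⊆Γ , ⊢Bs = Bs , Bs⊆Γ ,
      tautology ((x₀ ⇛ x₁ ⇛ x₂) ⇛ (x₂ ⇛ x₃) ⇛ x₀ ⇛ x₁ ⇛ x₃) (conj Bs ∷ B ∷ conj As ∷ C ∷ []) · ⊢Bs · ⊢C

  ⊢'-mono : ∀ {Γ Δ : FmSet {V} {n}} {A} → Γ ⊆ Δ → Γ ⊢' A → Δ ⊢' A
  ⊢'-mono Γ⊆Δ (As , As⊆Γ , ⊢A) = As , All.map Γ⊆Δ As⊆Γ , ⊢A

  Separable : FmSet {V} {n} → FmSet {V} {n} → FmSet {V} {n} → Set
  Separable L Γ Δ = Σ (Fm V n) λ C → C ∈ L × Γ ⊢' C × Δ ⊢' (~ C)

  Separable-mono : ∀ {L Γ Δ Γ' Δ' : FmSet {V} {n}} → Γ' ⊆ Γ → Δ' ⊆ Δ →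
                   Separable L Γ' Δ' → Separable L Γ Δ
  Separable-mono Γ'⊆Γ Δ'⊆Δ (C , C∈L , Γ'⊢C , Δ'⊢¬C) = C , C∈L , ⊢'-mono Γ'⊆Γ Γ'⊢C , ⊢'-mono Δ'⊆Δ Δ'⊢¬C

  Separable-language-mono : ∀ {L L' Γ Δ : FmSet {V} {n}} → L ⊆ L' → Separable L Γ Δ → Separable L' Γ Δ
  Separable-language-mono L⊆L' (C , C∈L , Γ⊢C , Δ⊢¬C) = C , L⊆L' C∈L , Γ⊢C , Δ⊢¬C

  ¬Separable⇒Consistent : ∀ {L Γ Δ : FmSet {V} {n}} → ⊥' ∈ L → ¬ Separable L Γ Δ → Consistent Γ
  ¬Separable⇒Consistent ⊥∈L Γ∦Δ Γ⊢⊥ = Γ∦Δ (⊥' , ⊥∈L , Γ⊢⊥ , ⊢'-theorem (tautology ⊤ˢ []))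

  record Extension (L T Γ Δ : FmSet {V} {n}) : Set₁ where
    field
      Γ⁺          : FmSet {V} {n}
      Γ⊆Γ⁺        : Γ ⊆ Γ⁺
      Γ⁺⊆T        : Γ⁺ ⊆ T
      inseparable : ¬ Separable L Γ⁺ Δ
      complete    : ∀ {A} → A ∈ T → A ∈ Γ⁺ ⊎ ~ A ∈ Γ⁺

  module _ {L : FmSet {V} {n}} (⊥∈L : ⊥' ∈ L) (⇒∈L : ∀ {A B} → A ∈ L → B ∈ L → (A ⇒ B) ∈ L) where

    Separable-sym : ∀ {Γ Δ} → Separable L Γ Δ → Separable L Δ Γ
    Separable-sym {Γ} {Δ} (C , C∈L , Γ⊢C , Δ⊢¬C) =
      ~ C , ⇒∈L C∈L ⊥∈L , Δ⊢¬C , ⊢'-mp Γ⊢C (tautology (x₀ ⇛ ¬ˢ ¬ˢ x₀) (C ∷ []))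

    Separable-cases : ∀ {Γ Δ A} → Separable L (Γ ∪ ｛ A ｝) Δ → Separable L (Γ ∪ ｛ ~ A ｝) Δ →
                      Separable L Γ Δ
    Separable-cases {A = A} (C₁ , C₁∈L , ΓA⊢C₁ , Δ⊢¬C₁) (C₂ , C₂∈L , Γ¬A⊢C₂ , Δ⊢¬C₂) =
      ~ C₁ ⇒ C₂ , ⇒∈L (⇒∈L C₁∈L ⊥∈L) C₂∈L ,
      ⊢'-mp₂ (⊢'-deduction ΓA⊢C₁) (⊢'-deduction Γ¬A⊢C₂)
             (tautology ((x₀ ⇛ x₁) ⇛ (¬ˢ x₀ ⇛ x₂) ⇛ ¬ˢ x₁ ⇛ x₂) (A ∷ C₁ ∷ C₂ ∷ [])) ,
      ⊢'-mp₂ Δ⊢¬C₁ Δ⊢¬C₂ (tautology (¬ˢ x₀ ⇛ ¬ˢ x₁ ⇛ ¬ˢ (¬ˢ x₀ ⇛ x₁)) (C₁ ∷ C₂ ∷ []))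

    module Lindenbaum (em : ExcludedMiddle 0ℓ) {T : FmSet {V} {n}} (¬∈T : ∀ {A} → A ∈ T → ~ A ∈ T)
                      (T-enumeration : Enumeration T)
                      {Γ Δ : FmSet {V} {n}} (Γ⊆T : Γ ⊆ T) (Γ∦Δ : ¬ Separable L Γ Δ) where

      e : ℕ → Fm V n
      e = proj₁ T-enumeration

      e∈T : ∀ k → e k ∈ T
      e∈T = proj₁ (proj₂ T-enumeration)

      e-onto : ∀ {A} → A ∈ T → ∃ λ k → e k ≡ A
      e-onto = proj₂ (proj₂ T-enumeration)

      Keeps : FmSet {V} {n} → Fm V n → Set
      Keeps Θ A = ¬ Separable L (Θ ∪ ｛ A ｝) Δ

      literal : ∀ {P : Set} → Dec P → Fm V n → Fm V n
      literal (yes _) A = A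
      literal (no _)  A = ~ A

      literal-keeps : ∀ {Θ A} (d : Dec (Keeps Θ A)) → ¬ Separable L Θ Δ → Keeps Θ (literal d A)
      literal-keeps (yes keeps)  Θ∦Δ = keeps
      literal-keeps (no ¬keeps) Θ∦Δ sep¬A = ¬keeps λ sepA → Θ∦Δ (Separable-cases sepA sep¬A)

      literal-∈T : ∀ {P : Set} (d : Dec P) {A} → A ∈ T → literal d A ∈ T
      literal-∈T (yes _) A∈T = A∈T
      literal-∈T (no _)  A∈T = ¬∈T A∈T

      literal-elim : ∀ {P : Set} (d : Dec P) {A} (Q : FmSet {V} {n}) → Q (literal d A) → Q A ⊎ Q (~ A)
      literal-elim (yes _) Q = inj₁
      literal-elim (no _)  Q = inj₂

      stage : ℕ → FmSet {V} {n}
      stage zero    = Γ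
      stage (suc k) = stage k ∪ ｛ literal (em {Keeps (stage k) (e k)}) (e k) ｝

      Γ⁺ : FmSet {V} {n}
      Γ⁺ A = ∃ λ k → A ∈ stage k

      stage-mono : ∀ {k m} → k ≤′ m → stage k ⊆ stage m
      stage-mono ≤′-refl        = λ A∈ → A∈
      stage-mono (≤′-step k≤′m) = inj₁ ∘ stage-mono k≤′m

      stage-⊆T : ∀ k → stage k ⊆ T
      stage-⊆T zero    = Γ⊆T
      stage-⊆T (suc k) (inj₁ A∈stage) = stage-⊆T k A∈stage
      stage-⊆T (suc k) (inj₂ refl)    = literal-∈T em (e∈T k)

      stage-inseparable : ∀ k → ¬ Separable L (stage k) Δ
      stage-inseparable zero    = Γ∦Δ
      stage-inseparable (suc k) = literal-keeps em (stage-inseparable k)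

      All-stage : ∀ {As} → All Γ⁺ As → ∃ λ m → All (stage m) As
      All-stage []                  = zero , []
      All-stage ((k , A∈stage) ∷ As⊆Γ⁺) with All-stage As⊆Γ⁺
      ... | m , As⊆stage = k ⊔ m , stage-mono (≤⇒≤′ (m≤m⊔n k m)) A∈stage
                                 ∷ All.map (stage-mono (≤⇒≤′ (m≤n⊔m k m))) As⊆stage

      Γ⁺-inseparable : ¬ Separable L Γ⁺ Δ
      Γ⁺-inseparable (C , C∈L , (As , As⊆Γ⁺ , ⊢C) , Δ⊢¬C) with All-stage As⊆Γ⁺
      ... | m , As⊆stage = stage-inseparable m (C , C∈L , (As , As⊆stage , ⊢C) , Δ⊢¬C)

      Γ⁺-complete : ∀ {A} → A ∈ T → A ∈ Γ⁺ ⊎ ~ A ∈ Γ⁺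
      Γ⁺-complete A∈T with e-onto A∈T
      ... | k , refl = Sum.map (suc k ,_) (suc k ,_) (literal-elim em (stage (suc k)) (inj₂ refl))

      extension : Extension L T Γ Δ
      extension = record
        { Γ⁺ = Γ⁺ ; Γ⊆Γ⁺ = zero ,_ ; Γ⁺⊆T = λ (k , A∈stage) → stage-⊆T k A∈stage
        ; inseparable = Γ⁺-inseparable ; complete = Γ⁺-complete }

  complete⇒MaxiConsistent : ∀ {Ag' V'} {Γ : FmSet {V} {n}} → Γ ⊆ Lang Ag' V' → Consistent Γ →
                            (∀ {A} → A ∈ Lang Ag' V' → A ∈ Γ ⊎ ~ A ∈ Γ) → MaxiConsistent Ag' V' Γ
  complete⇒MaxiConsistent Γ⊆L Γ-consistent complete =
    Γ⊆L , Γ-consistent , λ (Θ , Θ⊆L , Θ-consistent , Γ⊆Θ , A , A∈Θ , A∉Γ) →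
      Θ-consistent (Sum.[ ⊥-elim ∘ A∉Γ , contradictory A∈Θ ∘ Γ⊆Θ ] (complete (Θ⊆L A∈Θ)))
    where
    contradictory : ∀ {Θ : FmSet {V} {n}} {A} → A ∈ Θ → ~ A ∈ Θ → Θ ⊢' ⊥'
    contradictory {A = A} A∈Θ ¬A∈Θ =
      ⊢'-mp₂ (⊢'-assumption A∈Θ) (⊢'-assumption ¬A∈Θ) (tautology (x₀ ⇛ ¬ˢ x₀ ⇛ ⊥ˢ) (A ∷ []))

  module _ {Ag' : Pred (Fin n) 0ℓ} {V' : Pred V 0ℓ} where

    ⊥∈Lang : ⊥' ∈ Lang Ag' V'
    ⊥∈Lang = (λ _ ()) , (λ _ ())

    ⇒∈Lang : ∀ {A B} → A ∈ Lang Ag' V' → B ∈ Lang Ag' V' → (A ⇒ B) ∈ Lang Ag' V'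
    ⇒∈Lang (A-vars , A-agents) (B-vars , B-agents) =
      (λ { p (⇒ˡ o) → A-vars p o ; p (⇒ʳ o) → B-vars p o }) ,
      (λ { j (⇒ˡ o) → A-agents j o ; j (⇒ʳ o) → B-agents j o })

    ¬∈Lang : ∀ {A} → A ∈ Lang Ag' V' → ~ A ∈ Lang Ag' V'
    ¬∈Lang A∈L = ⇒∈Lang A∈L ⊥∈Lang

    agents-⊆ : ∀ {Γ : FmSet {V} {n}} → Γ ⊆ Lang Ag' V' → agents Γ ⊆ Ag'
    agents-⊆ Γ⊆L (A , A∈Γ , o) = proj₂ (Γ⊆L A∈Γ) _ o

    vars-⊆ : ∀ {Γ : FmSet {V} {n}} → Γ ⊆ Lang Ag' V' → vars Γ ⊆ V'
    vars-⊆ Γ⊆L (A , A∈Γ , o) = proj₁ (Γ⊆L A∈Γ) _ o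

  countable-extension : ExcludedMiddle 0ℓ → ∀ {Ag Ag' : Pred (Fin n) 0ℓ} {S S' : Pred V 0ℓ} {Γ Δ : FmSet {V} {n}} →
    AtMostCountable S → Γ ⊆ Lang Ag S → ¬ Separable (Lang Ag' S') Γ Δ → Extension (Lang Ag' S') (Lang Ag S) Γ Δ
  countable-extension em S-countable =
    Lindenbaum.extension ⊥∈Lang ⇒∈Lang em ¬∈Lang (enumerate em ⊥∈Lang (Lang-countable S-countable))

  Lang-mono : ∀ {Ag₁ Ag₂ : Pred (Fin n) 0ℓ} {V₁ V₂ : Pred V 0ℓ} → Ag₁ ⊆ Ag₂ → V₁ ⊆ V₂ → Lang Ag₁ V₁ ⊆ Lang Ag₂ V₂
  Lang-mono Ag₁⊆Ag₂ V₁⊆V₂ (A-vars , A-agents) = (λ p o → V₁⊆V₂ (A-vars p o)) , (λ j o → Ag₁⊆Ag₂ (A-agents j o))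

  ⊆Lang-self : ∀ (Γ : FmSet {V} {n}) → Γ ⊆ Lang (agents Γ) (vars Γ)
  ⊆Lang-self Γ {A} A∈Γ = (λ _ o → A , A∈Γ , o) , (λ _ o → A , A∈Γ , o)

  SharedLang : FmSet {V} {n} → FmSet {V} {n} → FmSet {V} {n}
  SharedLang Γ Δ = Lang (agents Γ ∪ agents Δ) (vars Γ ∩ vars Δ)

  Inseparable-restrict : ∀ {Γ Δ Γ' Δ' : FmSet {V} {n}} →
    Γ' ⊆ Lang (agents Γ) (vars Γ) → Δ' ⊆ Lang (agents Δ) (vars Δ) →
    Inseparable Γ Δ → ¬ Separable (SharedLang Γ Δ) Γ' Δ' → Inseparable Γ' Δ'
  Inseparable-restrict Γ'⊆L Δ'⊆L (disjoint , _) Γ'∦Δ' =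
    (λ j j∈Γ' j∈Δ' → disjoint j (agents-⊆ Γ'⊆L j∈Γ') (agents-⊆ Δ'⊆L j∈Δ')) ,
    Γ'∦Δ' ∘ Separable-language-mono
      (Lang-mono (Sum.map (agents-⊆ Γ'⊆L) (agents-⊆ Δ'⊆L)) (λ (p∈Γ' , p∈Δ') → vars-⊆ Γ'⊆L p∈Γ' , vars-⊆ Δ'⊆L p∈Δ'))

lemma3 : ExcludedMiddle 0ℓ →
    {V : Set} (n : ℕ) (Γ Δ : FmSet {V} {n}) →
    Inseparable Γ Δ →
    AtMostCountable (vars Γ) → AtMostCountable (vars Δ) →
    (Σ (FmSet {V} {n}) λ Γ' → Σ (FmSet {V} {n}) λ Δ' →
        Γ ⊆ Γ' × Γ' ⊆ Lang (agents Γ) (vars Γ) ×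
        Δ ⊆ Δ' × Δ' ⊆ Lang (agents Δ) (vars Δ) ×
        Inseparable Γ' Δ' ×
        MaxiConsistent (agents Γ) (vars Γ) Γ' ×
        MaxiConsistent (agents Δ) (vars Δ) Δ')
    ×
    (∀ (Γ' Δ' : FmSet {V} {n}) → Γ' ⊆ Γ → Δ' ⊆ Δ → Inseparable Γ' Δ')
lemma3 em n Γ Δ Γ∦Δ@(_ , ¬separable) Γ-countable Δ-countable =
  ( Γ.Γ⁺ , Δ.Γ⁺ , Γ.Γ⊆Γ⁺ , Γ.Γ⁺⊆T , Δ.Γ⊆Γ⁺ , Δ.Γ⁺⊆T
  , Inseparable-restrict Γ.Γ⁺⊆T Δ.Γ⁺⊆T Γ∦Δ Γ⁺∦Δ⁺
  , complete⇒MaxiConsistent Γ.Γ⁺⊆T (¬Separable⇒Consistent ⊥∈Lang Γ⁺∦Δ⁺) Γ.complete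
  , complete⇒MaxiConsistent Δ.Γ⁺⊆T (¬Separable⇒Consistent ⊥∈Lang Δ.inseparable) Δ.complete )
  , λ Γ' Δ' Γ'⊆Γ Δ'⊆Δ →
      Inseparable-restrict (⊆Lang-self Γ ∘ Γ'⊆Γ) (⊆Lang-self Δ ∘ Δ'⊆Δ) Γ∦Δ (¬separable ∘ Separable-mono Γ'⊆Γ Δ'⊆Δ)
  where
  module Γ = Extension (countable-extension em Γ-countable (⊆Lang-self Γ) ¬separable)
  module Δ = Extension (countable-extension em Δ-countable (⊆Lang-self Δ) (Γ.inseparable ∘ Separable-sym ⊥∈Lang ⇒∈Lang))

  Γ⁺∦Δ⁺ : ¬ Separable (SharedLang Γ Δ) Γ.Γ⁺ Δ.Γ⁺
  Γ⁺∦Δ⁺ = Δ.inseparable ∘ Separable-sym ⊥∈Lang ⇒∈Lang
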